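{- Let $N \ge 1$, let $G_N$ be the divisibility graph on $X_N=\{1,\dots,N\}$, and let $p \le N$ be a prime. Then the mean geodesic distance of $p$ is $$l_p = \frac{2N - \lfloor N/p \rfloor - 2}{N} = 2 - \frac{2}{N} - \frac{1}{N}\left\lfloor \frac{N}{p} \right\rfloor.$$
   Context: The divisibility graph $G_N$ is the simple undirected graph with vertex set $X_N=\{1,\dots,N\}$, in which two distinct vertices $i \ne j$ are adjacent if and only if $i$ divides $j$ or $j$ divides $i$ (no loops). For vertices $n,m$, $d_{nm}$ is the length of a shortest path between $n$ and $m$ (so $d_{nn}=0$). The mean geodesic distance of $n$ is $l_n = \frac{1}{N}\sum_{m \in X_N} d_{nm}$. $\lfloor x \rfloor$ denotes the floor of $x$. -}

module Defs where

open import Data.Nat using (ℕ; zero; suc; _+_; _≤_; NonZero)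
open import Data.Nat.Divisibility using (_∣_)
open import Data.Nat.Primality using (Prime; prime⇒nonZero)
import Data.Nat.DivMod as DM
open import Data.Integer using (ℤ; +_)
open import Data.Rational using (ℚ; _/_)
open import Data.Product using (_×_)
open import Data.Sum using (_⊎_)
open import Relation.Binary.PropositionalEquality using (_≢_)

InX : ℕ → ℕ → Set
InX N i = 1 ≤ i × i ≤ N

Adj : ℕ → ℕ → ℕ → Set
Adj N i j = InX N i × InX N j × i ≢ j × (i ∣ j ⊎ j ∣ i)

data Walk (N : ℕ) : ℕ → ℕ → ℕ → Set where
  here : ∀ {n} → Walk N 0 n n
  step : ∀ {k i j m} → Adj N i j → Walk N k j m → Walk N (suc k) i m

IsDist : ℕ → ℕ → ℕ → ℕ → Set
IsDist N n m k = Walk N k n m × (∀ k' → Walk N k' n m → k ≤ k')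

sumTo : (ℕ → ℕ) → ℕ → ℕ
sumTo f zero = 0
sumTo f (suc n) = sumTo f n + f (suc n)

-- mean geodesic distance (1/N) Σ_{m ∈ X_N} d m, given the distances d m = d_{nm}
meanDist : (N : ℕ) → .{{NonZero N}} → (ℕ → ℕ) → ℚ
meanDist N d = (+ sumTo d N) / N

floorDivPrime : ℕ → (p : ℕ) → Prime p → ℕ
floorDivPrime N p pr = DM._/_ N p {{prime⇒nonZero pr}}

-- In G_N the prime p is adjacent exactly to 1 and to its proper multiples,
-- since a divisor of p is 1 or p.  Every other vertex m ≠ p is two steps away,
-- through the universal neighbour 1.  Hence for every m ∈ X_N
--   d_{pm} + [m = 1] + [p ∣ m] + [m = p] = 2,
-- and summing over X_N, where p has ⌊N/p⌋ multiples, gives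
--   Σ_m d_{pm} + 1 + ⌊N/p⌋ + 1 = 2N.
module Submission where

open import Defs
open import Data.Nat using (ℕ; _≤_; NonZero)
open import Data.Nat.Primality using (Prime)
open import Data.Integer using (+_; _-_; _*_)
open import Data.Rational using (ℚ; _/_)
open import Relation.Binary.PropositionalEquality using (_≡_)

open import Data.Nat as ℕ using (_+_; zero; suc; NonTrivial; nonTrivial⇒n>1; _<_; _≟_; s≤s; z≤n; nonTrivial⇒≢1)
open import Data.Nat.Properties
  using (≤-refl; ≤-pred; ≤-trans; ≤-antisym; ≤∧≢⇒<; <⇒≤; m≤n⇒m≤1+n; <-trans; n<1+n; <-irrefl; +-comm; +-identityʳ; *-zeroʳ; 1+n≢0; *-suc;
         +-commutativeSemigroup)
open import Algebra.Properties.CommutativeSemigroup +-commutativeSemigroup using (interchange)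
open import Data.Nat.Divisibility using (_∣_; _∣?_; ∣-refl; 1∣_; ∣1⇒≡1; divides; n∣m⇒m%n≡0)
open import Data.Nat.DivMod
  using (_%_; m≡m%n+[m/n]*n; m%n<n; m<n⇒m%n≡m; m<n⇒m/n≡0; [m+kn]%n≡m%n; m*n/n≡m; 0/n≡0; +-distrib-/-∣ʳ)
  renaming (_/_ to _div_)
open import Data.Nat.Primality using (prime⇒nonZero; prime⇒nonTrivial; prime⇒irreducible)
open import Data.Integer as ℤ using ()
open import Data.Integer.Properties using (pos-+; pos-*)
open import Data.Integer.Tactic.RingSolver using (solve-∀)
open import Data.Product using (_,_)
open import Data.Sum using (_⊎_; inj₁; inj₂; [_,_]; swap)
open import Relation.Nullary using (Dec; yes; no; ¬_; contradiction)
open import Relation.Binary.PropositionalEquality using (_≢_; refl; sym; trans; cong; cong₂; module ≡-Reasoning)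
open ≡-Reasoning

indicator : {P : Set} → Dec P → ℕ
indicator (yes _) = 1
indicator (no _)  = 0

indicator-yes : ∀ {P : Set} (P? : Dec P) → P → indicator P? ≡ 1
indicator-yes (yes _)  _ = refl
indicator-yes (no ¬p) p = contradiction p ¬p

indicator-no : ∀ {P : Set} (P? : Dec P) → ¬ P → indicator P? ≡ 0
indicator-no (yes p) ¬p = contradiction p ¬p
indicator-no (no _)  _  = refl

sumTo-cong : ∀ {f g} n → (∀ m → InX n m → f m ≡ g m) → sumTo f n ≡ sumTo g n
sumTo-cong zero    f≗g = refl
sumTo-cong (suc n) f≗g =
  cong₂ _+_ (sumTo-cong n (λ m (1≤m , m≤n) → f≗g m (1≤m , m≤n⇒m≤1+n m≤n)))
            (f≗g (suc n) (s≤s z≤n , ≤-refl))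

sumTo-+ : ∀ f g n → sumTo (λ m → f m + g m) n ≡ sumTo f n + sumTo g n
sumTo-+ f g zero    = refl
sumTo-+ f g (suc n) rewrite sumTo-+ f g n = interchange (sumTo f n) (sumTo g n) (f (suc n)) (g (suc n))

sumTo-const : ∀ c n → sumTo (λ _ → c) n ≡ c ℕ.* n
sumTo-const c zero    = sym (*-zeroʳ c)
sumTo-const c (suc n) = trans (cong (_+ c) (sumTo-const c n)) (trans (+-comm (c ℕ.* n) c) (sym (*-suc c n)))

sumTo-indicator-≟-below : ∀ {q} n → n < q → sumTo (λ m → indicator (m ≟ q)) n ≡ 0
sumTo-indicator-≟-below zero    _   = refl
sumTo-indicator-≟-below {q} (suc n) 1+n<q with suc n ≟ q
... | yes 1+n≡q = contradiction 1+n<q (<-irrefl 1+n≡q)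
... | no _      = cong (_+ 0) (sumTo-indicator-≟-below n (<-trans (n<1+n n) 1+n<q))

sumTo-indicator-≟ : ∀ {q} n → InX n q → sumTo (λ m → indicator (m ≟ q)) n ≡ 1
sumTo-indicator-≟ zero    (() , z≤n)
sumTo-indicator-≟ {q} (suc n) (1≤q , q≤1+n) with suc n ≟ q
... | yes refl = cong (_+ 1) (sumTo-indicator-≟-below n (n<1+n n))
... | no 1+n≢q = trans (+-identityʳ _) (sumTo-indicator-≟ n (1≤q , q≤n))
  where q≤n = ≤-pred (≤∧≢⇒< q≤1+n (λ q≡1+n → 1+n≢q (sym q≡1+n)))

[r+q*d]/d≡q : ∀ r q d .{{_ : NonZero d}} → r < d → (r + q ℕ.* d) div d ≡ q
[r+q*d]/d≡q r q d r<d =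
  trans (+-distrib-/-∣ʳ r (divides q refl)) (cong₂ _+_ (m<n⇒m/n≡0 r<d) (m*n/n≡m q d))

suc≡suc[n%d]+[n/d]*d : ∀ n d .{{_ : NonZero d}} → suc n ≡ suc (n % d) + n div d ℕ.* d
suc≡suc[n%d]+[n/d]*d n d = cong suc (m≡m%n+[m/n]*n n d)

suc-div : ∀ n d .{{_ : NonZero d}} → suc n div d ≡ n div d + indicator (d ∣? suc n)
suc-div n d with suc (n % d) ≟ d
... | yes 1+r≡d = begin
  suc n div d                ≡⟨ cong (_div d) 1+n≡[1+q]*d ⟩
  suc q ℕ.* d div d          ≡⟨ m*n/n≡m (suc q) d ⟩
  suc q                      ≡⟨ +-comm 1 q ⟩
  q + 1                      ≡⟨ cong (_+_ q) (indicator-yes (d ∣? suc n) (divides (suc q) 1+n≡[1+q]*d)) ⟨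
  q + indicator (d ∣? suc n) ∎
  where
  q = n div d
  1+n≡[1+q]*d : suc n ≡ suc q ℕ.* d
  1+n≡[1+q]*d = trans (suc≡suc[n%d]+[n/d]*d n d) (cong (_+ q ℕ.* d) 1+r≡d)
... | no 1+r≢d = begin
  suc n div d                ≡⟨ cong (_div d) (suc≡suc[n%d]+[n/d]*d n d) ⟩
  (suc r + q ℕ.* d) div d    ≡⟨ [r+q*d]/d≡q (suc r) q d 1+r<d ⟩
  q                          ≡⟨ +-identityʳ q ⟨
  q + 0                      ≡⟨ cong (_+_ q) (indicator-no (d ∣? suc n) d∤1+n) ⟨
  q + indicator (d ∣? suc n) ∎
  where
  q = n div d
  r = n % d
  1+r<d : suc r < d
  1+r<d = ≤∧≢⇒< (m%n<n n d) 1+r≢d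
  d∤1+n : ¬ d ∣ suc n
  d∤1+n d∣1+n = 1+n≢0 (begin
    suc r                    ≡⟨ m<n⇒m%n≡m 1+r<d ⟨
    suc r % d                ≡⟨ [m+kn]%n≡m%n (suc r) q d ⟨
    (suc r + q ℕ.* d) % d    ≡⟨ cong (_% d) (suc≡suc[n%d]+[n/d]*d n d) ⟨
    suc n % d                ≡⟨ n∣m⇒m%n≡0 (suc n) d d∣1+n ⟩
    0                        ∎)

sumTo-indicator-∣ : ∀ n d .{{_ : NonZero d}} → sumTo (λ m → indicator (d ∣? m)) n ≡ n div d
sumTo-indicator-∣ zero    d = sym (0/n≡0 d)
sumTo-indicator-∣ (suc n) d = trans (cong (_+ indicator (d ∣? suc n)) (sumTo-indicator-∣ n d)) (sym (suc-div n d))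

module _ {N : ℕ} where

  adj-sym : ∀ {i j} → Adj N i j → Adj N j i
  adj-sym (i∈X , j∈X , i≢j , i∣j⊎j∣i) = j∈X , i∈X , (λ j≡i → i≢j (sym j≡i)) , swap i∣j⊎j∣i

  1∈X : ∀ {m} → InX N m → InX N 1
  1∈X (1≤m , m≤N) = ≤-refl , ≤-trans 1≤m m≤N

  1-adj : ∀ {m} → InX N m → m ≢ 1 → Adj N 1 m
  1-adj m∈X m≢1 = 1∈X m∈X , m∈X , (λ 1≡m → m≢1 (sym 1≡m)) , inj₁ (1∣ _)

  walk-via-1 : ∀ {n m} → InX N n → InX N m → n ≢ 1 → m ≢ 1 → Walk N 2 n m
  walk-via-1 n∈X m∈X n≢1 m≢1 = step (adj-sym (1-adj n∈X n≢1)) (step (1-adj m∈X m≢1) here)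

  walk₀⇒≡ : ∀ {n m} → Walk N 0 n m → n ≡ m
  walk₀⇒≡ here = refl

  walk₁⇒adj : ∀ {n m} → Walk N 1 n m → Adj N n m
  walk₁⇒adj (step n~m here) = n~m

  isDist-unique : ∀ {n m k j} → IsDist N n m k → IsDist N n m j → k ≡ j
  isDist-unique (walkₖ , k-min) (walkⱼ , j-min) = ≤-antisym (k-min _ walkⱼ) (j-min _ walkₖ)

  isDist-refl : ∀ {n} → IsDist N n n 0
  isDist-refl = here , λ _ _ → z≤n

  isDist-adj : ∀ {n m} → Adj N n m → IsDist N n m 1
  isDist-adj n~m@(_ , _ , n≢m , _) = step n~m here , shortest
    where
    shortest : ∀ k → Walk N k _ _ → 1 ≤ k
    shortest zero    w = contradiction (walk₀⇒≡ w) n≢m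
    shortest (suc _) _ = s≤s z≤n

  isDist-two : ∀ {n m} → Walk N 2 n m → n ≢ m → ¬ Adj N n m → IsDist N n m 2
  isDist-two w n≢m n≁m = w , shortest
    where
    shortest : ∀ k → Walk N k _ _ → 2 ≤ k
    shortest zero          w′ = contradiction (walk₀⇒≡ w′) n≢m
    shortest (suc zero)    w′ = contradiction (walk₁⇒adj w′) n≁m
    shortest (suc (suc _)) _  = s≤s (s≤s z≤n)

prime-adj⇒ : ∀ {N p m} → Prime p → Adj N p m → m ≡ 1 ⊎ p ∣ m
prime-adj⇒ _  (_ , _ , _   , inj₁ p∣m) = inj₂ p∣m
prime-adj⇒ pr (_ , _ , p≢m , inj₂ m∣p) with prime⇒irreducible pr m∣p
... | inj₁ m≡1 = inj₁ m≡1
... | inj₂ m≡p = contradiction (sym m≡p) p≢m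

module _ {N p : ℕ} (pr : Prime p) (p≤N : p ≤ N) where

  private instance
    p-nonZero : NonZero p
    p-nonZero = prime⇒nonZero pr
    p-nonTrivial : NonTrivial p
    p-nonTrivial = prime⇒nonTrivial pr

  p∈X : InX N p
  p∈X = <⇒≤ (nonTrivial⇒n>1 p) , p≤N

  p≢1 : p ≢ 1
  p≢1 = nonTrivial⇒≢1

  isDist-prime-indicators : ∀ {m k} → InX N m → IsDist N p m k →
    k + indicator (m ≟ 1) + indicator (p ∣? m) + indicator (m ≟ p) ≡ 2
  isDist-prime-indicators {m} m∈X dist with m ≟ 1 | p ∣? m | m ≟ p
  ... | yes refl | yes p∣1 | _        = contradiction (∣1⇒≡1 p∣1) p≢1
  ... | yes refl | no _    | yes 1≡p  = contradiction (sym 1≡p) p≢1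
  ... | yes refl | no _    | no _
    rewrite isDist-unique dist (isDist-adj (adj-sym (1-adj p∈X p≢1))) = refl
  ... | no _     | yes _   | yes refl
    rewrite isDist-unique dist isDist-refl = refl
  ... | no _     | yes p∣m | no m≢p
    rewrite isDist-unique dist (isDist-adj (p∈X , m∈X , (λ p≡m → m≢p (sym p≡m)) , inj₁ p∣m)) = refl
  ... | no _     | no p∤m  | yes refl = contradiction ∣-refl p∤m
  ... | no m≢1   | no p∤m  | no m≢p
    rewrite isDist-unique dist (isDist-two (walk-via-1 p∈X m∈X p≢1 m≢1) (λ p≡m → m≢p (sym p≡m))
                                         (λ p~m → [ m≢1 , p∤m ] (prime-adj⇒ pr p~m))) = refl

  sumTo-isDist-prime : (d : ℕ → ℕ) → (∀ m → InX N m → IsDist N p m (d m)) →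
                       sumTo d N + 1 + N div p + 1 ≡ 2 ℕ.* N
  sumTo-isDist-prime d isDist = begin
    sumTo d N + 1 + N div p + 1
      ≡⟨ cong (λ c → sumTo d N + 1 + c + 1) (sumTo-indicator-∣ N p) ⟨
    sumTo d N + 1 + sumTo [p∣_] N + 1
      ≡⟨ cong₂ (λ a b → sumTo d N + a + sumTo [p∣_] N + b)
               (sumTo-indicator-≟ N (1∈X p∈X)) (sumTo-indicator-≟ N p∈X) ⟨
    sumTo d N + sumTo [_≡1] N + sumTo [p∣_] N + sumTo [_≡p] N
      ≡⟨ cong (λ s → s + sumTo [p∣_] N + sumTo [_≡p] N) (sumTo-+ d [_≡1] N) ⟨
    sumTo (λ m → d m + [ m ≡1]) N + sumTo [p∣_] N + sumTo [_≡p] N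
      ≡⟨ cong (_+ sumTo [_≡p] N) (sumTo-+ (λ m → d m + [ m ≡1]) [p∣_] N) ⟨
    sumTo (λ m → d m + [ m ≡1] + [p∣ m ]) N + sumTo [_≡p] N
      ≡⟨ sumTo-+ (λ m → d m + [ m ≡1] + [p∣ m ]) [_≡p] N ⟨
    sumTo (λ m → d m + [ m ≡1] + [p∣ m ] + [ m ≡p]) N
      ≡⟨ sumTo-cong N (λ m m∈X → isDist-prime-indicators m∈X (isDist m m∈X)) ⟩
    sumTo (λ _ → 2) N
      ≡⟨ sumTo-const 2 N ⟩
    2 ℕ.* N ∎
    where
    [_≡1] [p∣_] [_≡p] : ℕ → ℕ
    [ m ≡1] = indicator (m ≟ 1)
    [p∣ m ] = indicator (p ∣? m)
    [ m ≡p] = indicator (m ≟ p)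

m+1+n+1≡o⇒o-n-2≡m : ∀ {m n o} → m + 1 + n + 1 ≡ o → + o - + n - + 2 ≡ + m
m+1+n+1≡o⇒o-n-2≡m {m} {n} refl = begin
  + (m + 1 + n + 1) - + n - + 2           ≡⟨ cong (λ z → z - + n - + 2) +[m+1+n+1]≡+m+1+n+1 ⟩
  + m ℤ.+ + 1 ℤ.+ + n ℤ.+ + 1 - + n - + 2 ≡⟨ cancel (+ m) (+ n) ⟩
  + m                                     ∎
  where
  +[m+1+n+1]≡+m+1+n+1 : + (m + 1 + n + 1) ≡ + m ℤ.+ + 1 ℤ.+ + n ℤ.+ + 1
  +[m+1+n+1]≡+m+1+n+1 = trans (pos-+ (m + 1 + n) 1)
    (cong (ℤ._+ + 1) (trans (pos-+ (m + 1) n) (cong (ℤ._+ + n) (pos-+ m 1))))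
  cancel : ∀ a b → a ℤ.+ + 1 ℤ.+ b ℤ.+ + 1 - b - + 2 ≡ a
  cancel = solve-∀

corollary3 : (N : ℕ) → .{{_ : NonZero N}} → (p : ℕ) → (pr : Prime p) → p ≤ N →
             (d : ℕ → ℕ) → (∀ m → InX N m → IsDist N p m (d m)) →
             meanDist N d ≡ ((+ 2 * + N) - + floorDivPrime N p pr - + 2) / N
corollary3 N p pr p≤N d isDist = sym (cong (_/ N) (begin
  + 2 * + N - + N/p - + 2       ≡⟨ cong (λ z → z - + N/p - + 2) (pos-* 2 N) ⟨
  + (2 ℕ.* N) - + N/p - + 2     ≡⟨ m+1+n+1≡o⇒o-n-2≡m (sumTo-isDist-prime pr p≤N d isDist) ⟩
  + sumTo d N                   ∎))
  where N/p = floorDivPrime N p pr
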